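{- Let $G=(A,B,E)$ be a finite bipartite graph with bipartition $A,B$ (so $A,B$ are disjoint stable sets with $A\cup B=V(G)$), whose number of isolated vertices is not $1$. Then either (i) $\xi(G)\geq 2$, or (ii) $\xi(G)=0$ and both $A$ and $B$ are maximum stable sets of $G$.
   Context: $\Omega(G)$ is the set of maximum stable sets of $G$; $core(G)=\bigcap\{S:S\in\Omega(G)\}$ and $\xi(G)=|core(G)|$. -}

module Defs where

open import Data.Nat using (ℕ; _≤_; _≡ᵇ_)
open import Data.Bool using (Bool; true; false; not)
open import Data.Fin using (Fin)
open import Data.Fin.Subset using (Subset; _∈_; ∣_∣)
open import Data.List using (allFin; map)
open import Data.Bool.ListAction using (and)
open import Data.Vec using (tabulate)
open import Data.Product using (_×_; ∃)
open import Relation.Binary.PropositionalEquality using (_≡_)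

record Graph (n : ℕ) : Set where
  field
    adj    : Fin n → Fin n → Bool
    sym    : ∀ x y → adj x y ≡ adj y x
    irrefl : ∀ x → adj x x ≡ false
open Graph public

Stable : ∀ {n} → Graph n → Subset n → Set
Stable G S = ∀ x y → x ∈ S → y ∈ S → adj G x y ≡ false

MaxStable : ∀ {n} → Graph n → Subset n → Set
MaxStable G S = Stable G S × (∀ T → Stable G T → ∣ T ∣ ≤ ∣ S ∣)

IsCore : ∀ {n} → Graph n → Subset n → Set
IsCore G C = ∀ x → (x ∈ C → ∀ S → MaxStable G S → x ∈ S)
                 × ((∀ S → MaxStable G S → x ∈ S) → x ∈ C)

Xi≡ : ∀ {n} → Graph n → ℕ → Set
Xi≡ G k = ∃ λ C → IsCore G C × ∣ C ∣ ≡ k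

Xi≥ : ∀ {n} → Graph n → ℕ → Set
Xi≥ G k = ∃ λ C → IsCore G C × k ≤ ∣ C ∣

isolatedᵇ : ∀ {n} → Graph n → Fin n → Bool
isolatedᵇ {n} G x = and (map (λ y → not (adj G x y)) (allFin n))

Isolated : ∀ {n} → Graph n → Subset n
Isolated G = tabulate (isolatedᵇ G)

numIsolated : ∀ {n} → Graph n → ℕ
numIsolated G = ∣ Isolated G ∣

IsBipartition : ∀ {n} → Graph n → Subset n → Subset n → Set
IsBipartition G A B =
  Stable G A × Stable G B
  × (∀ x → x ∈ A → x ∈ B → Data.Empty.⊥)
  × (∀ x → (x ∈ A) Data.Sum.⊎ (x ∈ B))
  where import Data.Empty; import Data.Sum

-- For maximum stable sets S, T of a bipartite graph with sides A, B, the sets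
-- (S ∩ T) ∪ ((S ∪ T) ∩ A) and (S ∩ T) ∪ ((S ∪ T) ∩ B) are stable and together have at
-- least |S| + |T| elements, so both are maximum. Repeating this with sets T that avoid a
-- non-core vertex of S ∩ B yields a maximum stable set S with S ∩ B ⊆ core(G).
-- If the core is empty, such an S lies inside A, so A is maximum (and B symmetrically).
-- If the core is a single vertex x ∈ A with a neighbour y, take S with S ∩ A ⊆ {x}; then
-- (S ∩ B) ∪ {y} is a maximum stable set missing x, which is absurd. So a core of size one
-- consists of isolated vertices; as isolated vertices always lie in the core, the graph
-- then has exactly one isolated vertex.

module Submission where

open import Data.Bool using (Bool; true; false)
import Data.Bool as Bool
open import Data.Bool.Properties using (T-≡; T-not-≡) renaming (_≟_ to _≟ᵇ_)
open import Data.Empty using (⊥-elim)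
open import Data.Fin using (Fin; _≟_)
open import Data.Fin.Properties using (all?; any?)
open import Data.Fin.Subset using (Subset; _∈_; _∉_; _⊆_; _∩_; _∪_; _-_; ⁅_⁆; ⊥; ∣_∣)
open import Data.Fin.Subset.Properties
open import Data.List.Relation.Unary.All.Properties using (all⁺; all⁻; tabulate⁺; tabulate⁻)
open import Data.Nat using (ℕ; suc; _+_; _∸_; _≤_; _<_; _<?_; s≤s; z≤n)
open import Data.Nat.Induction using (<-wellFounded)
open import Data.Nat.Properties
  using (+-suc; +-mono-≤; +-monoʳ-≤; +-cancelʳ-≤; ≤-reflexive; ≤-trans; ≤-antisym; <⇒≱; ≮⇒≥; ∸-monoʳ-<; module ≤-Reasoning)
open import Data.Product using (∃; _×_; _,_; proj₁; proj₂)
open import Data.Sum using (_⊎_; inj₁; inj₂; swap)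
open import Data.Vec using ([]; _∷_; tabulate)
open import Data.Vec.Properties using (lookup∘tabulate; []=⇒lookup; lookup⇒[]=)
open import Function using (_∘_; _⇔_; mk⇔; Equivalence)
open import Induction.WellFounded using (Acc; acc)
open import Relation.Binary.PropositionalEquality using (_≡_; _≢_; refl; sym; trans; cong; subst; subst₂)
open import Relation.Nullary using (Dec; yes; no; ¬_; ¬?; contradiction)
open import Relation.Nullary.Decidable
  using (_×-dec_; _→-dec_; map′; decidable-stable; ⌊_⌋; toWitness; fromWitness)
open import Relation.Unary using (Pred; Decidable)

open import Defs hiding (sym)

open Equivalence using (to; from)

private
  variable
    n : ℕ
    x y : Fin n
    p q r s : Subset n

∣p∩q∣+∣p∪q∣≡∣p∣+∣q∣ : ∀ (p q : Subset n) → ∣ p ∩ q ∣ + ∣ p ∪ q ∣ ≡ ∣ p ∣ + ∣ q ∣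
∣p∩q∣+∣p∪q∣≡∣p∣+∣q∣ []            []            = refl
∣p∩q∣+∣p∪q∣≡∣p∣+∣q∣ (true  ∷ p) (true  ∷ q) =
  cong suc (trans (+-suc _ _) (trans (cong suc (∣p∩q∣+∣p∪q∣≡∣p∣+∣q∣ p q)) (sym (+-suc _ _))))
∣p∩q∣+∣p∪q∣≡∣p∣+∣q∣ (true  ∷ p) (false ∷ q) = trans (+-suc _ _) (cong suc (∣p∩q∣+∣p∪q∣≡∣p∣+∣q∣ p q))
∣p∩q∣+∣p∪q∣≡∣p∣+∣q∣ (false ∷ p) (true  ∷ q) =
  trans (+-suc _ _) (trans (cong suc (∣p∩q∣+∣p∪q∣≡∣p∣+∣q∣ p q)) (sym (+-suc _ _)))
∣p∩q∣+∣p∪q∣≡∣p∣+∣q∣ (false ∷ p) (false ∷ q) = ∣p∩q∣+∣p∪q∣≡∣p∣+∣q∣ p q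

∩∪-⊆⇒∣p∣+∣q∣≤∣r∣+∣s∣ : p ∩ q ⊆ r ∩ s → p ∪ q ⊆ r ∪ s → ∣ p ∣ + ∣ q ∣ ≤ ∣ r ∣ + ∣ s ∣
∩∪-⊆⇒∣p∣+∣q∣≤∣r∣+∣s∣ {p = p} {q} {r} {s} p∩q⊆r∩s p∪q⊆r∪s = begin
  ∣ p ∣ + ∣ q ∣         ≡⟨ sym (∣p∩q∣+∣p∪q∣≡∣p∣+∣q∣ p q) ⟩
  ∣ p ∩ q ∣ + ∣ p ∪ q ∣ ≤⟨ +-mono-≤ (p⊆q⇒∣p∣≤∣q∣ p∩q⊆r∩s) (p⊆q⇒∣p∣≤∣q∣ p∪q⊆r∪s) ⟩
  ∣ r ∩ s ∣ + ∣ r ∪ s ∣ ≡⟨ ∣p∩q∣+∣p∪q∣≡∣p∣+∣q∣ r s ⟩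
  ∣ r ∣ + ∣ s ∣         ∎
  where open ≤-Reasoning

p⊆q∪⁅x⁆∧y∈q─p⇒∣p∣≤∣q∣ : p ⊆ q ∪ ⁅ x ⁆ → y ∈ q → y ∉ p → ∣ p ∣ ≤ ∣ q ∣
p⊆q∪⁅x⁆∧y∈q─p⇒∣p∣≤∣q∣ {p = p} {q} {x} {y} p⊆q∪⁅x⁆ y∈q y∉p =
  +-cancelʳ-≤ 1 (∣ p ∣) (∣ q ∣) (subst₂ (λ a b → ∣ p ∣ + a ≤ ∣ q ∣ + b) (∣⁅x⁆∣≡1 y) (∣⁅x⁆∣≡1 x)
    (∩∪-⊆⇒∣p∣+∣q∣≤∣r∣+∣s∣ p∩⁅y⁆⊆q∩⁅x⁆ p∪⁅y⁆⊆q∪⁅x⁆))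
  where
  p∩⁅y⁆⊆q∩⁅x⁆ : p ∩ ⁅ y ⁆ ⊆ q ∩ ⁅ x ⁆
  p∩⁅y⁆⊆q∩⁅x⁆ z∈p∩⁅y⁆ with x∈p∩q⁻ p ⁅ y ⁆ z∈p∩⁅y⁆
  ... | z∈p , z∈⁅y⁆ = contradiction (subst (_∈ p) (x∈⁅y⁆⇒x≡y y z∈⁅y⁆) z∈p) y∉p

  p∪⁅y⁆⊆q∪⁅x⁆ : p ∪ ⁅ y ⁆ ⊆ q ∪ ⁅ x ⁆
  p∪⁅y⁆⊆q∪⁅x⁆ z∈p∪⁅y⁆ with x∈p∪q⁻ p ⁅ y ⁆ z∈p∪⁅y⁆
  ... | inj₁ z∈p   = p⊆q∪⁅x⁆ z∈p
  ... | inj₂ z∈⁅y⁆ = x∈p∪q⁺ (inj₁ (subst (_∈ q) (sym (x∈⁅y⁆⇒x≡y y z∈⁅y⁆)) y∈q))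

x∉p⇒∣p∣<∣p∪⁅x⁆∣ : x ∉ p → ∣ p ∣ < ∣ p ∪ ⁅ x ⁆ ∣
x∉p⇒∣p∣<∣p∪⁅x⁆∣ {x = x} x∉p = p⊂q⇒∣p∣<∣q∣ (p⊆p∪q ⁅ x ⁆ , x , x∈p∪q⁺ (inj₂ (x∈⁅x⁆ x)) , x∉p)

x∈p⇒⁅x⁆⊆p : x ∈ p → ⁅ x ⁆ ⊆ p
x∈p⇒⁅x⁆⊆p {x = x} {p} x∈p y∈⁅x⁆ = subst (_∈ p) (sym (x∈⁅y⁆⇒x≡y x y∈⁅x⁆)) x∈p

∣p∣≡0⇒x∉p : ∣ p ∣ ≡ 0 → x ∉ p
∣p∣≡0⇒x∉p {x = x} ∣p∣≡0 x∈p =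
  contradiction (subst₂ _≤_ (∣⁅x⁆∣≡1 x) ∣p∣≡0 (p⊆q⇒∣p∣≤∣q∣ (x∈p⇒⁅x⁆⊆p x∈p))) λ ()

∣p∣≤1⇒x∈p⇒y∈p⇒x≡y : ∣ p ∣ ≤ 1 → x ∈ p → y ∈ p → x ≡ y
∣p∣≤1⇒x∈p⇒y∈p⇒x≡y {p = p} {x} {y} ∣p∣≤1 x∈p y∈p with x ≟ y
... | yes x≡y = x≡y
... | no  x≢y = contradiction ∣p∣≤1 (<⇒≱ (begin-strict
  1           ≡⟨ sym (∣⁅x⁆∣≡1 y) ⟩
  ∣ ⁅ y ⁆ ∣   ≤⟨ p⊆q⇒∣p∣≤∣q∣ (x∈p⇒⁅x⁆⊆p (x∈p∧x≢y⇒x∈p-y y∈p (x≢y ∘ sym))) ⟩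
  ∣ p - x ∣   <⟨ x∈p⇒∣p-x∣<∣p∣ x∈p ⟩
  ∣ p ∣       ∎))
  where open ≤-Reasoning

∈-tabulate⇔ : ∀ {f : Fin n → Bool} → x ∈ tabulate f ⇔ Bool.T (f x)
∈-tabulate⇔ {x = x} {f} = mk⇔
  (λ x∈ → from T-≡ (trans (sym (lookup∘tabulate f x)) ([]=⇒lookup x∈)))
  (λ fx → lookup⇒[]= x (tabulate f) (trans (lookup∘tabulate f x) (to T-≡ fx)))

IsLargest : ∀ {ℓ} → Pred (Subset n) ℓ → Subset n → Set ℓ
IsLargest P p = ∀ q → P q → ∣ q ∣ ≤ ∣ p ∣

module _ {n ℓ} {P : Pred (Subset n) ℓ} (P? : Decidable P) where

  larger? : ∀ (p : Subset n) → Dec (∃ λ q → P q × ∣ p ∣ < ∣ q ∣)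
  larger? p = anySubset? (λ q → P? q ×-dec ∣ p ∣ <? ∣ q ∣)

  ∄larger⇒largest : ∀ p → ¬ (∃ λ q → P q × ∣ p ∣ < ∣ q ∣) → IsLargest P p
  ∄larger⇒largest p ∄larger q Pq = ≮⇒≥ (λ p<q → ∄larger (q , Pq , p<q))

  isLargest? : ∀ p → Dec (IsLargest P p)
  isLargest? p = map′ (∄larger⇒largest p)
    (λ largest (q , Pq , p<q) → <⇒≱ p<q (largest q Pq)) (¬? (larger? p))

  ∃-largest : P p → ∃ λ q → P q × IsLargest P q
  ∃-largest {p} Pp = go p Pp (<-wellFounded (n ∸ ∣ p ∣))
    where
    go : ∀ p → P p → Acc _<_ (n ∸ ∣ p ∣) → ∃ λ q → P q × IsLargest P q
    go p Pp (acc rs) with larger? p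
    ... | yes (q , Pq , p<q) = go q Pq (rs (∸-monoʳ-< p<q (∣p∣≤n q)))
    ... | no  ∄larger        = p , Pp , ∄larger⇒largest p ∄larger

module _ {n} (G : Graph n) where

  private
    variable
      A B S T : Subset n

  stable? : Decidable (Stable G)
  stable? S = all? λ x → all? λ y → x ∈? S →-dec (y ∈? S →-dec adj G x y ≟ᵇ false)

  maxStable? : Decidable (MaxStable G)
  maxStable? S = stable? S ×-dec isLargest? stable? S

  ∃-maxStable : ∃ (MaxStable G)
  ∃-maxStable = ∃-largest stable? {⊥} λ x _ x∈⊥ _ → contradiction x∈⊥ ∉⊥

  maxStable-≤ : MaxStable G S → Stable G T → ∣ S ∣ ≤ ∣ T ∣ → MaxStable G T
  maxStable-≤ (_ , S-largest) stT ∣S∣≤∣T∣ = stT , λ U stU → ≤-trans (S-largest U stU) ∣S∣≤∣T∣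

  stable-⊆ : S ⊆ T → Stable G T → Stable G S
  stable-⊆ S⊆T stT x y x∈S y∈S = stT x y (S⊆T x∈S) (S⊆T y∈S)

  stable-∪⁅⁆ : (∀ y → adj G x y ≡ false) → Stable G S → Stable G (S ∪ ⁅ x ⁆)
  stable-∪⁅⁆ {x = x} {S} x-isolated stS u w u∈ w∈ with x∈p∪q⁻ S ⁅ x ⁆ u∈ | x∈p∪q⁻ S ⁅ x ⁆ w∈
  ... | inj₁ u∈S   | inj₁ w∈S   = stS u w u∈S w∈S
  ... | inj₂ u∈⁅x⁆ | _          rewrite x∈⁅y⁆⇒x≡y x u∈⁅x⁆ = x-isolated w
  ... | inj₁ _     | inj₂ w∈⁅x⁆ rewrite x∈⁅y⁆⇒x≡y x w∈⁅x⁆ = trans (Graph.sym G u x) (x-isolated u)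

  stable-∩-∪ : Stable G S → Stable G T → x ∈ S ∩ T → y ∈ S ∪ T → adj G x y ≡ false
  stable-∩-∪ {S} {T} {x} {y} stS stT x∈S∩T y∈S∪T with x∈p∩q⁻ S T x∈S∩T | x∈p∪q⁻ S T y∈S∪T
  ... | x∈S , _ | inj₁ y∈S = stS x y x∈S y∈S
  ... | _ , x∈T | inj₂ y∈T = stT x y x∈T y∈T

  stable-∩∪∩ : Stable G A → Stable G S → Stable G T → Stable G ((S ∩ T) ∪ ((S ∪ T) ∩ A))
  stable-∩∪∩ {A} {S} {T} stA stS stT x y x∈ y∈
    with x∈p∪q⁻ (S ∩ T) _ x∈ | x∈p∪q⁻ (S ∩ T) _ y∈
  ... | inj₁ x∈S∩T | inj₁ y∈S∩T = stable-∩-∪ stS stT x∈S∩T (p⊆p∪q T (proj₁ (x∈p∩q⁻ S T y∈S∩T)))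
  ... | inj₁ x∈S∩T | inj₂ y∈S∪T∩A = stable-∩-∪ stS stT x∈S∩T (proj₁ (x∈p∩q⁻ (S ∪ T) A y∈S∪T∩A))
  ... | inj₂ x∈S∪T∩A | inj₁ y∈S∩T =
    trans (Graph.sym G x y) (stable-∩-∪ stS stT y∈S∩T (proj₁ (x∈p∩q⁻ (S ∪ T) A x∈S∪T∩A)))
  ... | inj₂ x∈S∪T∩A | inj₂ y∈S∪T∩A =
    stA x y (proj₂ (x∈p∩q⁻ (S ∪ T) A x∈S∪T∩A)) (proj₂ (x∈p∩q⁻ (S ∪ T) A y∈S∪T∩A))

  Avoidable : Fin n → Set
  Avoidable x = ∃ λ S → MaxStable G S × x ∉ S

  avoidable? : Decidable Avoidable
  avoidable? x = anySubset? λ S → maxStable? S ×-dec ¬? (x ∈? S)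

  core : Subset n
  core = tabulate λ x → ⌊ ¬? (avoidable? x) ⌋

  ∈core⇔ : x ∈ core ⇔ (¬ Avoidable x)
  ∈core⇔ {x} = mk⇔ (toWitness {a? = ¬? (avoidable? x)} ∘ to ∈-tabulate⇔) (from ∈-tabulate⇔ ∘ fromWitness)

  ∈core⇒∈maxStable : x ∈ core → MaxStable G S → x ∈ S
  ∈core⇒∈maxStable {x} {S} x∈core S-max =
    decidable-stable (x ∈? S) λ x∉S → to ∈core⇔ x∈core (S , S-max , x∉S)

  ∉core⇒avoidable : x ∉ core → Avoidable x
  ∉core⇒avoidable {x} x∉core = decidable-stable (avoidable? x) (x∉core ∘ from ∈core⇔)

  core-isCore : IsCore G core
  core-isCore x = (λ x∈core S → ∈core⇒∈maxStable x∈core)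
                , λ x∈all → from ∈core⇔ λ (S , S-max , x∉S) → x∉S (x∈all S S-max)

  ∈Isolated⇔ : x ∈ Isolated G ⇔ (∀ y → adj G x y ≡ false)
  ∈Isolated⇔ = mk⇔
    (λ x∈ y → to T-not-≡ (tabulate⁻ (all⁺ _ _ (to ∈-tabulate⇔ x∈)) y))
    (λ x-isolated → from ∈-tabulate⇔ (all⁻ _ (tabulate⁺ (from T-not-≡ ∘ x-isolated))))

  Isolated⊆core : Isolated G ⊆ core
  Isolated⊆core {x} x∈ = from ∈core⇔ λ (S , (stS , S-largest) , x∉S) →
    <⇒≱ (x∉p⇒∣p∣<∣p∪⁅x⁆∣ x∉S) (S-largest _ (stable-∪⁅⁆ (to ∈Isolated⇔ x∈) stS))

  bipartition-sym : IsBipartition G A B → IsBipartition G B A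
  bipartition-sym (stA , stB , disjoint , cover) =
    stB , stA , (λ x x∈B x∈A → disjoint x x∈A x∈B) , swap ∘ cover

  maxStable-∩∪∩ : IsBipartition G A B → MaxStable G S → MaxStable G T →
                  MaxStable G ((S ∩ T) ∪ ((S ∪ T) ∩ A))
  maxStable-∩∪∩ {A} {B} {S} {T} (stA , stB , _ , cover) S-max@(stS , _) (stT , T-largest) =
    maxStable-≤ S-max (stable-∩∪∩ stA stS stT) ∣S∣≤∣U∣
    where
    U L : Subset n
    U = (S ∩ T) ∪ ((S ∪ T) ∩ A)
    L = (S ∩ T) ∪ ((S ∪ T) ∩ B)

    S∩T⊆U∩L : S ∩ T ⊆ U ∩ L
    S∩T⊆U∩L x∈S∩T = x∈p∩q⁺ (x∈p∪q⁺ (inj₁ x∈S∩T) , x∈p∪q⁺ (inj₁ x∈S∩T))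

    S∪T⊆U∪L : S ∪ T ⊆ U ∪ L
    S∪T⊆U∪L {x} x∈S∪T with cover x
    ... | inj₁ x∈A = x∈p∪q⁺ (inj₁ (x∈p∪q⁺ (inj₂ (x∈p∩q⁺ (x∈S∪T , x∈A)))))
    ... | inj₂ x∈B = x∈p∪q⁺ (inj₂ (x∈p∪q⁺ (inj₂ (x∈p∩q⁺ (x∈S∪T , x∈B)))))

    ∣S∣≤∣U∣ : ∣ S ∣ ≤ ∣ U ∣
    ∣S∣≤∣U∣ = +-cancelʳ-≤ (∣ T ∣) (∣ S ∣) (∣ U ∣) (begin
      ∣ S ∣ + ∣ T ∣ ≤⟨ ∩∪-⊆⇒∣p∣+∣q∣≤∣r∣+∣s∣ S∩T⊆U∩L S∪T⊆U∪L ⟩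
      ∣ U ∣ + ∣ L ∣ ≤⟨ +-monoʳ-≤ ∣ U ∣ (T-largest L (stable-∩∪∩ stB stS stT)) ⟩
      ∣ U ∣ + ∣ T ∣ ∎)
      where open ≤-Reasoning

  ∣∩∪∩∩B∣<∣S∩B∣ : IsBipartition G A B → x ∈ S ∩ B → x ∉ T →
                  ∣ ((S ∩ T) ∪ ((S ∪ T) ∩ A)) ∩ B ∣ < ∣ S ∩ B ∣
  ∣∩∪∩∩B∣<∣S∩B∣ {A} {B} {x} {S} {T} (_ , _ , disjoint , _) x∈S∩B x∉T =
    p⊂q⇒∣p∣<∣q∣ (U∩B⊆S∩B , x , x∈S∩B , x∉U∩B)
    where
    U : Subset n
    U = (S ∩ T) ∪ ((S ∪ T) ∩ A)

    U∩B⊆S∩T : U ∩ B ⊆ S ∩ T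
    U∩B⊆S∩T {z} z∈U∩B with x∈p∩q⁻ U B z∈U∩B
    ... | z∈U , z∈B with x∈p∪q⁻ (S ∩ T) _ z∈U
    ...   | inj₁ z∈S∩T   = z∈S∩T
    ...   | inj₂ z∈S∪T∩A = ⊥-elim (disjoint z (proj₂ (x∈p∩q⁻ (S ∪ T) A z∈S∪T∩A)) z∈B)

    U∩B⊆S∩B : U ∩ B ⊆ S ∩ B
    U∩B⊆S∩B z∈U∩B = x∈p∩q⁺ (proj₁ (x∈p∩q⁻ S T (U∩B⊆S∩T z∈U∩B)) , proj₂ (x∈p∩q⁻ U B z∈U∩B))

    x∉U∩B : x ∉ U ∩ B
    x∉U∩B x∈U∩B = x∉T (proj₂ (x∈p∩q⁻ S T (U∩B⊆S∩T x∈U∩B)))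

  ∃-maxStable-∩⊆core : IsBipartition G A B → ∃ λ S → MaxStable G S × S ∩ B ⊆ core
  ∃-maxStable-∩⊆core {A} {B} bip with ∃-maxStable
  ... | S₀ , S₀-max = go S₀ S₀-max (<-wellFounded ∣ S₀ ∩ B ∣)
    where
    go : ∀ S → MaxStable G S → Acc _<_ ∣ S ∩ B ∣ → ∃ λ S → MaxStable G S × S ∩ B ⊆ core
    go S S-max (acc rs) with any? (λ x → x ∈? S ∩ B ×-dec ¬? (x ∈? core))
    ... | no ∄x = S , S-max , λ {x} x∈S∩B →
      decidable-stable (x ∈? core) λ x∉core → ∄x (x , x∈S∩B , x∉core)
    ... | yes (x , x∈S∩B , x∉core) with ∉core⇒avoidable x∉core
    ...   | T , T-max , x∉T =
      go _ (maxStable-∩∪∩ bip S-max T-max) (rs (∣∩∪∩∩B∣<∣S∩B∣ bip x∈S∩B x∉T))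

  ∣core∣≡0⇒maxStable : IsBipartition G A B → ∣ core ∣ ≡ 0 → MaxStable G A
  ∣core∣≡0⇒maxStable {A} {B} bip@(stA , _ , _ , cover) ∣core∣≡0 with ∃-maxStable-∩⊆core bip
  ... | S , S-max , S∩B⊆core = maxStable-≤ S-max stA (p⊆q⇒∣p∣≤∣q∣ S⊆A)
    where
    S⊆A : S ⊆ A
    S⊆A {x} x∈S with cover x
    ... | inj₁ x∈A = x∈A
    ... | inj₂ x∈B = contradiction (S∩B⊆core (x∈p∩q⁺ (x∈S , x∈B))) (∣p∣≡0⇒x∉p ∣core∣≡0)

  ∣core∣≤1⇒core∩A-isolated : IsBipartition G A B → ∣ core ∣ ≤ 1 → x ∈ core → x ∈ A →
                             adj G x y ≡ false
  ∣core∣≤1⇒core∩A-isolated {A} {B} {x} {y} bip@(stA , stB , disjoint , cover) ∣core∣≤1 x∈core x∈A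
    with adj G x y in x~y | ∃-maxStable-∩⊆core (bipartition-sym bip)
  ... | false | _ = refl
  ... | true  | S , S-max , S∩A⊆core =
    contradiction (∈core⇒∈maxStable x∈core Y-max) λ x∈Y → disjoint x x∈A (Y⊆B x∈Y)
    where
    y∉stable∋x : ∀ {U} → Stable G U → x ∈ U → y ∉ U
    y∉stable∋x stU x∈U y∈U = contradiction (trans (sym x~y) (stU x y x∈U y∈U)) λ ()

    y∈B : y ∈ B
    y∈B with cover y
    ... | inj₁ y∈A = contradiction y∈A (y∉stable∋x stA x∈A)
    ... | inj₂ y∈B = y∈B

    Y : Subset n
    Y = (S ∩ B) ∪ ⁅ y ⁆

    Y⊆B : Y ⊆ B
    Y⊆B z∈Y with x∈p∪q⁻ (S ∩ B) ⁅ y ⁆ z∈Y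
    ... | inj₁ z∈S∩B = proj₂ (x∈p∩q⁻ S B z∈S∩B)
    ... | inj₂ z∈⁅y⁆ = subst (_∈ B) (sym (x∈⁅y⁆⇒x≡y y z∈⁅y⁆)) y∈B

    S⊆Y∪⁅x⁆ : S ⊆ Y ∪ ⁅ x ⁆
    S⊆Y∪⁅x⁆ {z} z∈S with cover z
    ... | inj₁ z∈A = x∈p∪q⁺ (inj₂ (subst (_∈ ⁅ x ⁆)
          (∣p∣≤1⇒x∈p⇒y∈p⇒x≡y ∣core∣≤1 x∈core (S∩A⊆core (x∈p∩q⁺ (z∈S , z∈A)))) (x∈⁅x⁆ x)))
    ... | inj₂ z∈B = x∈p∪q⁺ (inj₁ (x∈p∪q⁺ (inj₁ (x∈p∩q⁺ (z∈S , z∈B)))))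

    Y-max : MaxStable G Y
    Y-max = maxStable-≤ S-max (stable-⊆ Y⊆B stB)
      (p⊆q∪⁅x⁆∧y∈q─p⇒∣p∣≤∣q∣ S⊆Y∪⁅x⁆ (x∈p∪q⁺ (inj₂ (x∈⁅x⁆ y)))
        (y∉stable∋x (proj₁ S-max) (∈core⇒∈maxStable x∈core S-max)))

  ∣core∣≤1⇒core⊆Isolated : IsBipartition G A B → ∣ core ∣ ≤ 1 → core ⊆ Isolated G
  ∣core∣≤1⇒core⊆Isolated bip@(_ , _ , _ , cover) ∣core∣≤1 {x} x∈core with cover x
  ... | inj₁ x∈A = from ∈Isolated⇔ λ _ → ∣core∣≤1⇒core∩A-isolated bip ∣core∣≤1 x∈core x∈A
  ... | inj₂ x∈B =
    from ∈Isolated⇔ λ _ → ∣core∣≤1⇒core∩A-isolated (bipartition-sym bip) ∣core∣≤1 x∈core x∈B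

  ∣core∣≤1⇒numIsolated≡∣core∣ : IsBipartition G A B → ∣ core ∣ ≤ 1 → numIsolated G ≡ ∣ core ∣
  ∣core∣≤1⇒numIsolated≡∣core∣ bip ∣core∣≤1 =
    ≤-antisym (p⊆q⇒∣p∣≤∣q∣ Isolated⊆core) (p⊆q⇒∣p∣≤∣q∣ (∣core∣≤1⇒core⊆Isolated bip ∣core∣≤1))

proposition7 : ∀ {n} (G : Graph n) (A B : Subset n) → IsBipartition G A B
    → numIsolated G ≢ 1
    → Xi≥ G 2 ⊎ (Xi≡ G 0 × MaxStable G A × MaxStable G B)
proposition7 G A B bip numIsolated≢1 with ∣ core G ∣ in ∣core∣≡
... | 0 = inj₂ ( (core G , core-isCore G , ∣core∣≡)
               , ∣core∣≡0⇒maxStable G bip ∣core∣≡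
               , ∣core∣≡0⇒maxStable G (bipartition-sym G bip) ∣core∣≡)
... | 1 = contradiction
  (trans (∣core∣≤1⇒numIsolated≡∣core∣ G bip (≤-reflexive ∣core∣≡)) ∣core∣≡) numIsolated≢1
... | suc (suc _) = inj₁ (core G , core-isCore G , subst (2 ≤_) (sym ∣core∣≡) (s≤s (s≤s z≤n)))
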